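{- Let $t$ be an odd positive integer and $s$ a non-negative integer. There exists a sequence $c_0,\dots,c_s$ with each $c_i\in\{0,1\}$ such that for every integer $m \ge s+1$, $$t^{2^m} \equiv 1 + \sum_{i=0}^{s} c_i 2^{m+2+i} \pmod{2^{m+s+3}}.$$ Moreover, $c_0,\dots,c_s$ are the first $s+1$ binary digits of the integer $a=(t^{2^{s+1}}-1)/2^{s+3}$, i.e. writing $a=\sum_{i\ge 0} c_i 2^i$ with $c_i\in\{0,1\}$, these are the coefficients $c_0,\dots,c_s$.
   Context: It is a known fact that $t^{2^{s+1}}\equiv 1 \pmod{2^{s+3}}$ for odd $t$, so $a$ is an integer. -}

module Defs where

open import Data.Nat using (ℕ; zero; suc; _+_; _*_; _∸_; _^_)
open import Data.Nat.DivMod using (_/_; _%_)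
open import Data.Nat.Properties using (m^n≢0)
open import Data.Fin using (Fin; toℕ)
open import Data.Fin.Base as Fin using ()

modPow2 : ℕ → ℕ → ℕ
modPow2 x k = _%_ x (2 ^ k) {{m^n≢0 2 k}}

divPow2 : ℕ → ℕ → ℕ
divPow2 x k = _/_ x (2 ^ k) {{m^n≢0 2 k}}

sumFin : (n : ℕ) → (Fin n → ℕ) → ℕ
sumFin zero    f = 0
sumFin (suc n) f = f Fin.zero + sumFin n (λ i → f (Fin.suc i))

binDigit : ℕ → ℕ → ℕ
binDigit a i = divPow2 a i % 2

-- a = (t^{2^{s+1}} - 1) / 2^{s+3}  (exact division for odd t, a known fact)
aOf : ℕ → ℕ → ℕ
aOf t s = divPow2 ((t ^ (2 ^ (suc s))) ∸ 1) (s + 3)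

{-# OPTIONS --safe #-}
module Submission where

-- For odd t = 1 + 2u one has t² = 1 + 8·(u(u+1)/2), and squaring 1 + 2^(k+1)·y gives
-- 1 + 2^(k+2)·(y + 2^k·y²); so t^(2^(s+1)) = 1 + 2^(s+3)·a.  Squaring further, for
-- m ≥ s+1 one has t^(2^m) = 1 + 2^(m+2)·y_m where the correction term 2^(m+1)·y_m² added to
-- y_m at each step is a multiple of 2^(s+1): hence y_m ≡ a (mod 2^(s+1)), and modulo
-- 2^(m+s+3) only these s+1 low binary digits of a survive.

open import Defs
open import Data.Nat using (ℕ; zero; suc; _+_; _*_; _∸_; _^_; _≤_; _%_; _/_; s≤s)
open import Data.Nat.Properties
open import Data.Nat.DivMod
open import Data.Nat.Solver using (module +-*-Solver)
open +-*-Solver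
open import Data.Fin as Fin using (Fin; toℕ)
open import Data.Product using (Σ; ∃; _×_; _,_)
open import Data.Sum using (_⊎_; inj₁; inj₂)
open import Relation.Binary.PropositionalEquality
open ≡-Reasoning

sumFin-cong : ∀ n {f g : Fin n → ℕ} → (∀ i → f i ≡ g i) → sumFin n f ≡ sumFin n g
sumFin-cong zero    f≗g = refl
sumFin-cong (suc n) f≗g = cong₂ _+_ (f≗g Fin.zero) (sumFin-cong n (λ i → f≗g (Fin.suc i)))

sumFin-*ˡ : ∀ n c (f : Fin n → ℕ) → sumFin n (λ i → c * f i) ≡ c * sumFin n f
sumFin-*ˡ zero    c f = sym (*-zeroʳ c)
sumFin-*ˡ (suc n) c f = begin
  c * f Fin.zero + sumFin n (λ i → c * f (Fin.suc i)) ≡⟨ cong (c * f Fin.zero +_) (sumFin-*ˡ n c _) ⟩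
  c * f Fin.zero + c * sumFin n (λ i → f (Fin.suc i)) ≡⟨ *-distribˡ-+ c _ _ ⟨
  c * sumFin (suc n) f                                 ∎

modPow2-suc : ∀ a n → modPow2 a (suc n) ≡ modPow2 (a / 2) n * 2 + a % 2
modPow2-suc a n = begin
  a % (2 * 2 ^ n)                         ≡⟨ %-congʳ (*-comm 2 (2 ^ n)) ⟩
  a % (2 ^ n * 2)                         ≡⟨ %-congˡ (trans (m≡m%n+[m/n]*n a 2) (+-comm (a % 2) _)) ⟩
  (a / 2 * 2 + a % 2) % (2 ^ n * 2)       ≡⟨ [m*n+o]%[p*n]≡[m*n]%[p*n]+o (a / 2) (2 ^ n) (m%n<n a 2) ⟩
  a / 2 * 2 % (2 ^ n * 2) + a % 2         ≡⟨ cong (_+ a % 2) (m%n*o≡m*o%[n*o] (a / 2) (2 ^ n) 2) ⟨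
  modPow2 (a / 2) n * 2 + a % 2           ∎
  where instance
    _ = m^n≢0 2 n
    _ = m^n≢0 2 (suc n)
    _ = m*n≢0 (2 ^ n) 2

binDigit-suc : ∀ a i → binDigit a (suc i) ≡ binDigit (a / 2) i
binDigit-suc a i = cong (_% 2) (sym (m/n/o≡m/[n*o] a 2 (2 ^ i)))
  where instance
    _ = m^n≢0 2 i
    _ = m^n≢0 2 (suc i)

binDigit-0⊎1 : ∀ a i → binDigit a i ≡ 0 ⊎ binDigit a i ≡ 1
binDigit-0⊎1 a i with binDigit a i | m%n<n (divPow2 a i) 2
... | 0 | _ = inj₁ refl
... | 1 | _ = inj₂ refl
... | suc (suc _) | s≤s (s≤s ())

binary-expansion : ∀ n a → sumFin n (λ i → binDigit a (toℕ i) * 2 ^ toℕ i) ≡ modPow2 a n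
binary-expansion zero    a = sym (n%1≡0 a)
binary-expansion (suc n) a = begin
  binDigit a 0 * 1 + sumFin n (λ i → binDigit a (suc (toℕ i)) * 2 ^ suc (toℕ i))
    ≡⟨ cong₂ _+_ lowest-digit (sumFin-cong n shift) ⟩
  a % 2 + sumFin n (λ i → 2 * (binDigit (a / 2) (toℕ i) * 2 ^ toℕ i))
    ≡⟨ cong (a % 2 +_) (sumFin-*ˡ n 2 _) ⟩
  a % 2 + 2 * sumFin n (λ i → binDigit (a / 2) (toℕ i) * 2 ^ toℕ i)
    ≡⟨ cong (λ r → a % 2 + 2 * r) (binary-expansion n (a / 2)) ⟩
  a % 2 + 2 * modPow2 (a / 2) n
    ≡⟨ trans (+-comm (a % 2) _) (cong (_+ a % 2) (*-comm 2 (modPow2 (a / 2) n))) ⟩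
  modPow2 (a / 2) n * 2 + a % 2
    ≡⟨ modPow2-suc a n ⟨
  modPow2 a (suc n) ∎
  where
  lowest-digit : binDigit a 0 * 1 ≡ a % 2
  lowest-digit = trans (*-identityʳ _) (cong (_% 2) (n/1≡n a))
  shift : ∀ (i : Fin n) → binDigit a (suc (toℕ i)) * 2 ^ suc (toℕ i)
                        ≡ 2 * (binDigit (a / 2) (toℕ i) * 2 ^ toℕ i)
  shift i rewrite binDigit-suc a (toℕ i) =
    solve 2 (λ d p → d :* (con 2 :* p) := con 2 :* (d :* p)) refl (binDigit (a / 2) (toℕ i)) (2 ^ toℕ i)

binary-expansion-scaled : ∀ n k a →
  sumFin n (λ i → binDigit a (toℕ i) * 2 ^ (k + toℕ i)) ≡ 2 ^ k * modPow2 a n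
binary-expansion-scaled n k a = begin
  sumFin n (λ i → binDigit a (toℕ i) * 2 ^ (k + toℕ i))  ≡⟨ sumFin-cong n scale ⟩
  sumFin n (λ i → 2 ^ k * (binDigit a (toℕ i) * 2 ^ toℕ i)) ≡⟨ sumFin-*ˡ n (2 ^ k) _ ⟩
  2 ^ k * sumFin n (λ i → binDigit a (toℕ i) * 2 ^ toℕ i) ≡⟨ cong (2 ^ k *_) (binary-expansion n a) ⟩
  2 ^ k * modPow2 a n                                      ∎
  where
  scale : ∀ (i : Fin n) → binDigit a (toℕ i) * 2 ^ (k + toℕ i) ≡ 2 ^ k * (binDigit a (toℕ i) * 2 ^ toℕ i)
  scale i rewrite ^-distribˡ-+-* 2 k (toℕ i) =
    solve 3 (λ d p q → d :* (p :* q) := p :* (d :* q)) refl (binDigit a (toℕ i)) (2 ^ k) (2 ^ toℕ i)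

^-2^-suc : ∀ t k → t ^ (2 ^ suc k) ≡ t ^ (2 ^ k) * t ^ (2 ^ k)
^-2^-suc t k = trans (cong (λ e → t ^ (2 ^ k + e)) (+-identityʳ (2 ^ k))) (^-distribˡ-+-* t (2 ^ k) (2 ^ k))

[1+2^[1+k]*y]² : ∀ k y →
  (1 + 2 ^ suc k * y) * (1 + 2 ^ suc k * y) ≡ 1 + 2 ^ suc (suc k) * (y + 2 ^ k * (y * y))
[1+2^[1+k]*y]² k y = solve 2 (λ q y →
    (con 1 :+ con 2 :* q :* y) :* (con 1 :+ con 2 :* q :* y)
  := con 1 :+ con 2 :* (con 2 :* q) :* (y :+ q :* (y :* y))) refl (2 ^ k) y

triangle : ℕ → ℕ
triangle zero    = 0
triangle (suc u) = triangle u + suc u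

odd-square : ∀ u → (1 + 2 * u) * (1 + 2 * u) ≡ 1 + 8 * triangle u
odd-square zero    = refl
odd-square (suc u) = begin
  (1 + 2 * suc u) * (1 + 2 * suc u)        ≡⟨ solve 1 (λ u →
      (con 1 :+ con 2 :* (con 1 :+ u)) :* (con 1 :+ con 2 :* (con 1 :+ u))
    := (con 1 :+ con 2 :* u) :* (con 1 :+ con 2 :* u) :+ con 8 :* (con 1 :+ u)) refl u ⟩
  (1 + 2 * u) * (1 + 2 * u) + 8 * suc u    ≡⟨ cong (_+ 8 * suc u) (odd-square u) ⟩
  1 + 8 * triangle u + 8 * suc u           ≡⟨ solve 2 (λ w u →
      con 1 :+ con 8 :* w :+ con 8 :* u := con 1 :+ con 8 :* (w :+ u)) refl (triangle u) (suc u) ⟩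
  1 + 8 * triangle (suc u)                 ∎

odd-tower : ∀ {t} u → t ≡ 1 + 2 * u → ∀ k → ∃ λ b → t ^ (2 ^ suc k) ≡ 1 + 2 ^ (3 + k) * b
odd-tower {t} u refl zero = triangle u , trans (cong (t *_) (*-identityʳ t)) (odd-square u)
odd-tower {t} u t≡1+2u (suc k) with odd-tower u t≡1+2u k
... | b , eq = b + 2 ^ (2 + k) * (b * b) ,
  trans (^-2^-suc t (suc k)) (trans (cong₂ _*_ eq eq) ([1+2^[1+k]*y]² (2 + k) b))

aOf-exact : ∀ {t s b} → t ^ (2 ^ suc s) ≡ 1 + 2 ^ (3 + s) * b → aOf t s ≡ b
aOf-exact {t} {s} {b} eq rewrite eq | +-comm s 3 =
  trans (/-congˡ (*-comm (2 ^ (3 + s)) b)) (m*n/n≡m b (2 ^ (3 + s)))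
  where instance _ = m^n≢0 2 (3 + s)

odd-tower-aOf : ∀ {t} s → t % 2 ≡ 1 → t ^ (2 ^ suc s) ≡ 1 + 2 ^ (3 + s) * aOf t s
odd-tower-aOf {t} s t-odd =
  let b , eq = odd-tower (t / 2) t≡1+2u s
  in trans eq (cong (λ a → 1 + 2 ^ (3 + s) * a) (sym (aOf-exact {t} {s} eq)))
  where
  t≡1+2u : t ≡ 1 + 2 * (t / 2)
  t≡1+2u = trans (m≡m%n+[m/n]*n t 2) (cong₂ _+_ t-odd (*-comm (t / 2) 2))

[1+2^k*[y+2^l*e]]%2^[k+l]≡[1+2^k*[y%2^l]]%2^[k+l] : ∀ k l y e →
  modPow2 (1 + 2 ^ k * (y + 2 ^ l * e)) (k + l) ≡ modPow2 (1 + 2 ^ k * modPow2 y l) (k + l)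
[1+2^k*[y+2^l*e]]%2^[k+l]≡[1+2^k*[y%2^l]]%2^[k+l] k l y e = begin
  (1 + 2 ^ k * (y + 2 ^ l * e)) % 2 ^ (k + l)
    ≡⟨ %-congˡ {o = 2 ^ (k + l)} (cong (λ x → 1 + 2 ^ k * (x + 2 ^ l * e)) (m≡m%n+[m/n]*n y (2 ^ l))) ⟩
  (1 + 2 ^ k * (y % 2 ^ l + y / 2 ^ l * 2 ^ l + 2 ^ l * e)) % 2 ^ (k + l)
    ≡⟨ %-congˡ {o = 2 ^ (k + l)} regroup ⟩
  (1 + 2 ^ k * (y % 2 ^ l) + (y / 2 ^ l + e) * 2 ^ (k + l)) % 2 ^ (k + l)
    ≡⟨ [m+kn]%n≡m%n (1 + 2 ^ k * modPow2 y l) (y / 2 ^ l + e) (2 ^ (k + l)) ⟩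
  (1 + 2 ^ k * (y % 2 ^ l)) % 2 ^ (k + l) ∎
  where
  instance
    _ = m^n≢0 2 l
    _ = m^n≢0 2 (k + l)
  regroup : 1 + 2 ^ k * (y % 2 ^ l + y / 2 ^ l * 2 ^ l + 2 ^ l * e)
          ≡ 1 + 2 ^ k * (y % 2 ^ l) + (y / 2 ^ l + e) * 2 ^ (k + l)
  regroup rewrite ^-distribˡ-+-* 2 k l = solve 5 (λ p l r q e →
      con 1 :+ p :* (r :+ q :* l :+ l :* e) := con 1 :+ p :* r :+ (q :+ e) :* (p :* l))
    refl (2 ^ k) (2 ^ l) (y % 2 ^ l) (y / 2 ^ l) e

tower-lift : ∀ {t s A} → t ^ (2 ^ suc s) ≡ 1 + 2 ^ (3 + s) * A →
  ∀ j → ∃ λ e → t ^ (2 ^ (j + suc s)) ≡ 1 + 2 ^ (2 + (j + suc s)) * (A + 2 ^ suc s * e)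
tower-lift {s = s} {A} eq zero =
  0 , trans eq (cong (λ a → 1 + 2 ^ (3 + s) * a) (sym (trans (cong (A +_) (*-zeroʳ (2 ^ suc s))) (+-identityʳ A))))
tower-lift {t} {s} {A} eq (suc j) with tower-lift eq j
... | e , eqⱼ = e + 2 ^ suc j * (y * y) , (begin
  t ^ (2 ^ suc n)                               ≡⟨ ^-2^-suc t n ⟩
  t ^ (2 ^ n) * t ^ (2 ^ n)                     ≡⟨ cong₂ _*_ eqⱼ eqⱼ ⟩
  (1 + 2 ^ (2 + n) * y) * (1 + 2 ^ (2 + n) * y) ≡⟨ [1+2^[1+k]*y]² (suc n) y ⟩
  1 + 2 ^ (3 + n) * (y + 2 ^ suc n * (y * y))   ≡⟨ cong (λ x → 1 + 2 ^ (3 + n) * x) absorb ⟩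
  1 + 2 ^ (3 + n) * (A + 2 ^ suc s * (e + 2 ^ suc j * (y * y))) ∎)
  where
  n = j + suc s
  y = A + 2 ^ suc s * e
  absorb : y + 2 ^ suc n * (y * y) ≡ A + 2 ^ suc s * (e + 2 ^ suc j * (y * y))
  absorb rewrite ^-distribˡ-+-* 2 (suc j) (suc s) = solve 5 (λ a S e J w →
      a :+ S :* e :+ J :* S :* w := a :+ S :* (e :+ J :* w))
    refl A (2 ^ suc s) e (2 ^ suc j) (y * y)

tower-congruence : ∀ {t s A} → t ^ (2 ^ suc s) ≡ 1 + 2 ^ (3 + s) * A → ∀ m → suc s ≤ m →
  modPow2 (t ^ (2 ^ m)) (m + s + 3) ≡ modPow2 (1 + 2 ^ (m + 2) * modPow2 A (suc s)) (m + s + 3)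
tower-congruence {t} {s} {A} eq m s<m with m ∸ suc s | m∸n+n≡m s<m
... | j | refl with tower-lift eq j
... | e , eqⱼ = begin
  modPow2 (t ^ (2 ^ m)) (m + s + 3)
    ≡⟨ cong₂ modPow2 eqⱼ exponent ⟩
  modPow2 (1 + 2 ^ (2 + m) * (A + 2 ^ suc s * e)) (2 + m + suc s)
    ≡⟨ [1+2^k*[y+2^l*e]]%2^[k+l]≡[1+2^k*[y%2^l]]%2^[k+l] (2 + m) (suc s) A e ⟩
  modPow2 (1 + 2 ^ (2 + m) * modPow2 A (suc s)) (2 + m + suc s)
    ≡⟨ cong₂ (λ k K → modPow2 (1 + 2 ^ k * modPow2 A (suc s)) K) (+-comm 2 m) (sym exponent) ⟩
  modPow2 (1 + 2 ^ (m + 2) * modPow2 A (suc s)) (m + s + 3) ∎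
  where
  exponent : m + s + 3 ≡ 2 + m + suc s
  exponent = solve 2 (λ m s → m :+ s :+ con 3 := con 2 :+ m :+ (con 1 :+ s)) refl m s

proposition3p2 : (t s : ℕ) → t % 2 ≡ 1 →
    Σ (Fin (suc s) → ℕ) (λ c →
      ((i : Fin (suc s)) → c i ≡ 0 ⊎ c i ≡ 1)
      × ((m : ℕ) → suc s ≤ m →
          modPow2 (t ^ (2 ^ m)) (m + s + 3)
            ≡ modPow2 (1 + sumFin (suc s) (λ i → c i * 2 ^ (m + 2 + toℕ i))) (m + s + 3))
      × ((i : Fin (suc s)) → c i ≡ binDigit (aOf t s) (toℕ i)))
proposition3p2 t s t-odd = digit , (λ i → binDigit-0⊎1 a (toℕ i)) , congruence , (λ i → refl)
  where
  a = aOf t s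
  digit : Fin (suc s) → ℕ
  digit i = binDigit a (toℕ i)
  congruence : ∀ m → suc s ≤ m →
    modPow2 (t ^ (2 ^ m)) (m + s + 3)
      ≡ modPow2 (1 + sumFin (suc s) (λ i → digit i * 2 ^ (m + 2 + toℕ i))) (m + s + 3)
  congruence m s<m = trans (tower-congruence (odd-tower-aOf s t-odd) m s<m)
    (cong (λ x → modPow2 (1 + x) (m + s + 3)) (sym (binary-expansion-scaled (suc s) (m + 2) a)))
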